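{- Let $\mathcal V=\mathcal V_i\cup\mathcal V_c$ with $\mathcal V_i\cap\mathcal V_c=\emptyset$, and let $\tilde{\mathcal F}$ be the set of all formulas over $\mathcal V$, $\tilde{\mathcal K}=\{F\in\tilde{\mathcal F} : var(F)\subseteq\mathcal V_c\cup\{\perp\}\}$, $\tilde{\mathcal I}=\{F\in\tilde{\mathcal F} : var(F)\subseteq\mathcal V_i\cup\{0\}\}$, and $\tilde{\mathcal P}=\tilde{\mathcal F}\setminus\tilde{\mathcal I}$. Then: (1) If $\Gamma,\Delta$ are finite multisets of formulas of $\tilde{\mathcal K}$, then $\Gamma\vdash_{\tilde{\mathcal P}}\Delta;$ if and only if $\Gamma\vdash_{\mathrm{LK}}\Delta$. (2) If $\Gamma$ is a finite multiset of formulas of $\tilde{\mathcal I}$ and $A\in\tilde{\mathcal I}$, then $\Gamma\vdash_{\tilde{\mathcal P}} ;A$ if and only if $\Gamma\vdash_{\mathrm{LJ}} A$.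
   Context: Formulas are given by the grammar $F ::= 0 \mid \perp \mid X \mid F\wedge F \mid F\vee F \mid F\rightarrow F$, where $X$ ranges over a set $\mathcal V$ of propositional variables and $0$, $\perp$ are two distinct constants. For a formula $F$, $var(F)$ is the set of variables and constants ($0$, $\perp$) occurring in $F$. $\mathrm{LK}$ denotes Gentzen's classical propositional sequent calculus over formulas built from variables and the constant $\perp$ with $\wedge,\vee,\rightarrow$, with $\perp$ as absurdity (axiom $\perp\vdash$); $\mathrm{LJ}$ denotes Gentzen's intuitionistic propositional sequent calculus over formulas built from variables and the constant $0$ with $\wedge,\vee,\rightarrow$, with $0$ as absurdity (rule $\Gamma,0\vdash C$). Fix a set $\mathcal P$ of formulas. A $\mathcal P$-sequent is an expression $\Gamma\vdash\Delta;\Pi$ where $\Gamma,\Delta,\Pi$ are finite multisets of formulas, every formula of $\Delta$ (the body) belongs to $\mathcal P$, and $\Pi$ (the stoup) contains at most one formula. The system $\mathrm{ML}_{\mathcal P}$ derives $\mathcal P$-sequents with the following rules (below $C$ denotes a single formula, $\Pi$ a stoup with at most one formula, and all sequents must be $\mathcal P$-sequents): Axiom/cuts: $ax$: $A\vdash ;A$. $cut_1$: from $\Gamma\vdash\Delta;A$ and $\Gamma',A\vdash\Delta';\Pi$ infer $\Gamma,\Gamma'\vdash\Delta,\Delta';\Pi$. $cut_2$: from $\Gamma\vdash\Delta,A;\Pi$ and $\Gamma',A\vdash\Delta';$ infer $\Gamma,\Gamma'\vdash\Delta,\Delta';\Pi$. Structure: $der$: from $\Gamma\vdash\Delta;A$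 with $A\in\mathcal P$ infer $\Gamma\vdash\Delta,A;$. $c_l$: from $\Gamma,A,A\vdash\Delta;\Pi$ infer $\Gamma,A\vdash\Delta;\Pi$. $c_r$: from $\Gamma\vdash\Delta,A,A;\Pi$ infer $\Gamma\vdash\Delta,A;\Pi$. $w_l$: from $\Gamma\vdash\Delta;\Pi$ infer $\Gamma,A\vdash\Delta;\Pi$. $w_r$: from $\Gamma\vdash\Delta;\Pi$ with $A\in\mathcal P$ infer $\Gamma\vdash\Delta,A;\Pi$. Logic: $0$: $\Gamma,0\vdash\Delta;\Pi$ (any $\Delta\subseteq\mathcal P$). $\perp$: $\perp\vdash ;$. $\wedge^1_l$: from $\Gamma,A,B\vdash\Delta;C$ with $A\notin\mathcal P$ and $B\notin\mathcal P$ infer $\Gamma,A\wedge B\vdash\Delta;C$. $\wedge^2_l$: from $\Gamma,A,B\vdash\Delta;$ infer $\Gamma,A\wedge B\vdash\Delta;$. $\wedge^1_r$: from $\Gamma\vdash\Delta;A$ and $\Gamma'\vdash\Delta';B$ infer $\Gamma,\Gamma'\vdash\Delta,\Delta';A\wedge B$. $\wedge^2_r$: from $\Gamma\vdash\Delta,A;$ and $\Gamma'\vdash\Delta',B;$ infer the same conclusion. $\wedge^3_r$: from $\Gamma\vdash\Delta;A$ and $\Gamma'\vdash\Delta',B;$ infer the same conclusion. $\wedge^4_r$: from $\Gamma\vdash\Delta,A;$ and $\Gamma'\vdash\Delta';B$ infer the same conclusion. $\vee^1_l$: from $\Gamma,A\vdash\Delta;C$ and $\Gamma,B\vdash\Delta;C$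 with $A\notin\mathcal P$ and $B\notin\mathcal P$ infer $\Gamma,A\vee B\vdash\Delta;C$. $\vee^2_l$: from $\Gamma,A\vdash\Delta;$ and $\Gamma,B\vdash\Delta;$ infer $\Gamma,A\vee B\vdash\Delta;$. $\vee^1_r$: from $\Gamma\vdash\Delta;A$ infer $\Gamma\vdash\Delta;A\vee B$. $\vee^2_r$: from $\Gamma\vdash\Delta;B$ infer $\Gamma\vdash\Delta;A\vee B$. $\vee^3_r$: from $\Gamma\vdash\Delta,A;$ infer $\Gamma\vdash\Delta;A\vee B$. $\vee^4_r$: from $\Gamma\vdash\Delta,B;$ infer $\Gamma\vdash\Delta;A\vee B$. $\rightarrow^1_l$: from $\Gamma,B\vdash\Delta;C$ and $\Gamma'\vdash\Delta';A$ with $B\notin\mathcal P$ infer $\Gamma,\Gamma',A\rightarrow B\vdash\Delta,\Delta';C$. $\rightarrow^2_l$: from $\Gamma,B\vdash\Delta;$ and $\Gamma'\vdash\Delta';A$ infer $\Gamma,\Gamma',A\rightarrow B\vdash\Delta,\Delta';$. $\rightarrow^3_l$: from $\Gamma,B\vdash\Delta;$ and $\Gamma'\vdash\Delta',A;\Pi$ infer $\Gamma,\Gamma',A\rightarrow B\vdash\Delta,\Delta';\Pi$. $\rightarrow^1_r$: from $\Gamma,A\vdash\Delta;B$ infer $\Gamma\vdash\Delta;A\rightarrow B$. $\rightarrow^2_r$: from $\Gamma,A\vdash\Delta,B;$ infer $\Gamma\vdash\Delta;A\rightarrow B$. One writes $\Gamma\vdash_{\mathcal P}\Delta;\Pi$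 when the $\mathcal P$-sequent $\Gamma\vdash\Delta;\Pi$ is derivable in $\mathrm{ML}_{\mathcal P}$. -}

module Defs where

open import Data.Empty using (⊥)
open import Data.Unit using (⊤)
open import Data.Sum using (_⊎_; inj₁; inj₂)
open import Data.Maybe using (Maybe; just; nothing)
open import Data.List using (List; []; _∷_; _++_; [_])
open import Data.List.Relation.Unary.All using (All)
open import Data.List.Relation.Binary.Permutation.Propositional using (_↭_)
open import Relation.Nullary using (¬_)
open import Relation.Binary.PropositionalEquality using (_≡_)
open import Function.Bundles using (_⇔_)
open import Data.Product using (_×_)

infixr 6 _∧̇_
infixr 5 _∨̇_
infixr 4 _⇒_

data Formula (V : Set) : Set where
  𝟘    : Formula V            -- the constant 0 (intuitionistic absurdity)
  ⊥̇    : Formula V            -- the constant ⊥ (classical absurdity)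
  var  : V → Formula V
  _∧̇_  : Formula V → Formula V → Formula V
  _∨̇_  : Formula V → Formula V → Formula V
  _⇒_  : Formula V → Formula V → Formula V

data Atom (V : Set) : Set where
  aVar  : V → Atom V
  a𝟘    : Atom V
  a⊥    : Atom V

atoms : {V : Set} → Formula V → List (Atom V)
atoms 𝟘       = [ a𝟘 ]
atoms ⊥̇       = [ a⊥ ]
atoms (var x) = [ aVar x ]
atoms (A ∧̇ B) = atoms A ++ atoms B
atoms (A ∨̇ B) = atoms A ++ atoms B
atoms (A ⇒ B) = atoms A ++ atoms B

-- Multisets are lists; the rule 'perm' closes under permutation.
-- "Γ, A" is written A ∷ Γ; "Δ, A" is written A ∷ Δ.  Stoup = Maybe.

module ML {V : Set} (P : Formula V → Set) where

  infix 3 _⊢_⨾_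

  data _⊢_⨾_ : List (Formula V) → List (Formula V) → Maybe (Formula V) → Set where
    ax   : ∀ {A} → [ A ] ⊢ [] ⨾ just A
    cut₁ : ∀ {Γ Γ' Δ Δ' A Π} → Γ ⊢ Δ ⨾ just A → A ∷ Γ' ⊢ Δ' ⨾ Π → Γ ++ Γ' ⊢ Δ ++ Δ' ⨾ Π
    cut₂ : ∀ {Γ Γ' Δ Δ' A Π} → Γ ⊢ A ∷ Δ ⨾ Π → A ∷ Γ' ⊢ Δ' ⨾ nothing → Γ ++ Γ' ⊢ Δ ++ Δ' ⨾ Π
    der  : ∀ {Γ Δ A} → P A → Γ ⊢ Δ ⨾ just A → Γ ⊢ A ∷ Δ ⨾ nothing
    cₗ   : ∀ {Γ Δ A Π} → A ∷ A ∷ Γ ⊢ Δ ⨾ Π → A ∷ Γ ⊢ Δ ⨾ Π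
    cᵣ   : ∀ {Γ Δ A Π} → Γ ⊢ A ∷ A ∷ Δ ⨾ Π → Γ ⊢ A ∷ Δ ⨾ Π
    wₗ   : ∀ {Γ Δ A Π} → Γ ⊢ Δ ⨾ Π → A ∷ Γ ⊢ Δ ⨾ Π
    wᵣ   : ∀ {Γ Δ A Π} → P A → Γ ⊢ Δ ⨾ Π → Γ ⊢ A ∷ Δ ⨾ Π
    perm : ∀ {Γ Γ' Δ Δ' Π} → Γ ↭ Γ' → Δ ↭ Δ' → Γ ⊢ Δ ⨾ Π → Γ' ⊢ Δ' ⨾ Π
    zero : ∀ {Γ Δ Π} → All P Δ → 𝟘 ∷ Γ ⊢ Δ ⨾ Π
    bot  : [ ⊥̇ ] ⊢ [] ⨾ nothing
    ∧ₗ¹  : ∀ {Γ Δ A B C} → ¬ P A → ¬ P B → A ∷ B ∷ Γ ⊢ Δ ⨾ just C → (A ∧̇ B) ∷ Γ ⊢ Δ ⨾ just C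
    ∧ₗ²  : ∀ {Γ Δ A B} → A ∷ B ∷ Γ ⊢ Δ ⨾ nothing → (A ∧̇ B) ∷ Γ ⊢ Δ ⨾ nothing
    ∧ᵣ¹  : ∀ {Γ Γ' Δ Δ' A B} → Γ ⊢ Δ ⨾ just A → Γ' ⊢ Δ' ⨾ just B → Γ ++ Γ' ⊢ Δ ++ Δ' ⨾ just (A ∧̇ B)
    ∧ᵣ²  : ∀ {Γ Γ' Δ Δ' A B} → Γ ⊢ A ∷ Δ ⨾ nothing → Γ' ⊢ B ∷ Δ' ⨾ nothing → Γ ++ Γ' ⊢ Δ ++ Δ' ⨾ just (A ∧̇ B)
    ∧ᵣ³  : ∀ {Γ Γ' Δ Δ' A B} → Γ ⊢ Δ ⨾ just A → Γ' ⊢ B ∷ Δ' ⨾ nothing → Γ ++ Γ' ⊢ Δ ++ Δ' ⨾ just (A ∧̇ B)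
    ∧ᵣ⁴  : ∀ {Γ Γ' Δ Δ' A B} → Γ ⊢ A ∷ Δ ⨾ nothing → Γ' ⊢ Δ' ⨾ just B → Γ ++ Γ' ⊢ Δ ++ Δ' ⨾ just (A ∧̇ B)
    ∨ₗ¹  : ∀ {Γ Δ A B C} → ¬ P A → ¬ P B → A ∷ Γ ⊢ Δ ⨾ just C → B ∷ Γ ⊢ Δ ⨾ just C → (A ∨̇ B) ∷ Γ ⊢ Δ ⨾ just C
    ∨ₗ²  : ∀ {Γ Δ A B} → A ∷ Γ ⊢ Δ ⨾ nothing → B ∷ Γ ⊢ Δ ⨾ nothing → (A ∨̇ B) ∷ Γ ⊢ Δ ⨾ nothing
    ∨ᵣ¹  : ∀ {Γ Δ A B} → Γ ⊢ Δ ⨾ just A → Γ ⊢ Δ ⨾ just (A ∨̇ B)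
    ∨ᵣ²  : ∀ {Γ Δ A B} → Γ ⊢ Δ ⨾ just B → Γ ⊢ Δ ⨾ just (A ∨̇ B)
    ∨ᵣ³  : ∀ {Γ Δ A B} → Γ ⊢ A ∷ Δ ⨾ nothing → Γ ⊢ Δ ⨾ just (A ∨̇ B)
    ∨ᵣ⁴  : ∀ {Γ Δ A B} → Γ ⊢ B ∷ Δ ⨾ nothing → Γ ⊢ Δ ⨾ just (A ∨̇ B)
    ⇒ₗ¹  : ∀ {Γ Γ' Δ Δ' A B C} → ¬ P B → B ∷ Γ ⊢ Δ ⨾ just C → Γ' ⊢ Δ' ⨾ just A
           → (A ⇒ B) ∷ (Γ ++ Γ') ⊢ Δ ++ Δ' ⨾ just C
    ⇒ₗ²  : ∀ {Γ Γ' Δ Δ' A B} → B ∷ Γ ⊢ Δ ⨾ nothing → Γ' ⊢ Δ' ⨾ just A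
           → (A ⇒ B) ∷ (Γ ++ Γ') ⊢ Δ ++ Δ' ⨾ nothing
    ⇒ₗ³  : ∀ {Γ Γ' Δ Δ' A B Π} → B ∷ Γ ⊢ Δ ⨾ nothing → Γ' ⊢ A ∷ Δ' ⨾ Π
           → (A ⇒ B) ∷ (Γ ++ Γ') ⊢ Δ ++ Δ' ⨾ Π
    ⇒ᵣ¹  : ∀ {Γ Δ A B} → A ∷ Γ ⊢ Δ ⨾ just B → Γ ⊢ Δ ⨾ just (A ⇒ B)
    ⇒ᵣ²  : ∀ {Γ Δ A B} → A ∷ Γ ⊢ B ∷ Δ ⨾ nothing → Γ ⊢ Δ ⨾ just (A ⇒ B)

-- Its language consists of the formulas without the constant 0; since
-- every formula of a derivation except cut formulas occurs in the
-- conclusion, we restrict cut formulas to be 0-free.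

Zero-free : {V : Set} → Formula V → Set
Zero-free A = All (λ a → ¬ (a ≡ a𝟘)) (atoms A)

Bot-free : {V : Set} → Formula V → Set
Bot-free A = All (λ a → ¬ (a ≡ a⊥)) (atoms A)

infix 3 _⊢LK_
data _⊢LK_ {V : Set} : List (Formula V) → List (Formula V) → Set where
  ax   : ∀ {A} → [ A ] ⊢LK [ A ]
  cut  : ∀ {Γ Π Δ Λ A} → Zero-free A → Γ ⊢LK A ∷ Δ → A ∷ Π ⊢LK Λ → Γ ++ Π ⊢LK Δ ++ Λ
  wₗ   : ∀ {Γ Δ A} → Γ ⊢LK Δ → A ∷ Γ ⊢LK Δ
  wᵣ   : ∀ {Γ Δ A} → Γ ⊢LK Δ → Γ ⊢LK A ∷ Δ
  cₗ   : ∀ {Γ Δ A} → A ∷ A ∷ Γ ⊢LK Δ → A ∷ Γ ⊢LK Δ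
  cᵣ   : ∀ {Γ Δ A} → Γ ⊢LK A ∷ A ∷ Δ → Γ ⊢LK A ∷ Δ
  perm : ∀ {Γ Γ' Δ Δ'} → Γ ↭ Γ' → Δ ↭ Δ' → Γ ⊢LK Δ → Γ' ⊢LK Δ'
  bot  : [ ⊥̇ ] ⊢LK []
  ∧ₗ¹  : ∀ {Γ Δ A B} → A ∷ Γ ⊢LK Δ → (A ∧̇ B) ∷ Γ ⊢LK Δ
  ∧ₗ²  : ∀ {Γ Δ A B} → B ∷ Γ ⊢LK Δ → (A ∧̇ B) ∷ Γ ⊢LK Δ
  ∧ᵣ   : ∀ {Γ Δ A B} → Γ ⊢LK A ∷ Δ → Γ ⊢LK B ∷ Δ → Γ ⊢LK (A ∧̇ B) ∷ Δ
  ∨ₗ   : ∀ {Γ Δ A B} → A ∷ Γ ⊢LK Δ → B ∷ Γ ⊢LK Δ → (A ∨̇ B) ∷ Γ ⊢LK Δ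
  ∨ᵣ¹  : ∀ {Γ Δ A B} → Γ ⊢LK A ∷ Δ → Γ ⊢LK (A ∨̇ B) ∷ Δ
  ∨ᵣ²  : ∀ {Γ Δ A B} → Γ ⊢LK B ∷ Δ → Γ ⊢LK (A ∨̇ B) ∷ Δ
  ⇒ₗ   : ∀ {Γ Π Δ Λ A B} → Γ ⊢LK A ∷ Δ → B ∷ Π ⊢LK Λ → (A ⇒ B) ∷ (Γ ++ Π) ⊢LK Δ ++ Λ
  ⇒ᵣ   : ∀ {Γ Δ A B} → A ∷ Γ ⊢LK B ∷ Δ → Γ ⊢LK (A ⇒ B) ∷ Δ

-- LJ: Gentzen's intuitionistic sequent calculus with 0 as absurdity
-- (single-formula succedent).  Cut formulas are ⊥-free (LJ's language).

infix 3 _⊢LJ_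
data _⊢LJ_ {V : Set} : List (Formula V) → Formula V → Set where
  ax   : ∀ {A} → [ A ] ⊢LJ A
  cut  : ∀ {Γ Π A C} → Bot-free A → Γ ⊢LJ A → A ∷ Π ⊢LJ C → Γ ++ Π ⊢LJ C
  wₗ   : ∀ {Γ A C} → Γ ⊢LJ C → A ∷ Γ ⊢LJ C
  cₗ   : ∀ {Γ A C} → A ∷ A ∷ Γ ⊢LJ C → A ∷ Γ ⊢LJ C
  perm : ∀ {Γ Γ' C} → Γ ↭ Γ' → Γ ⊢LJ C → Γ' ⊢LJ C
  zero : ∀ {Γ C} → 𝟘 ∷ Γ ⊢LJ C
  ∧ₗ¹  : ∀ {Γ A B C} → A ∷ Γ ⊢LJ C → (A ∧̇ B) ∷ Γ ⊢LJ C
  ∧ₗ²  : ∀ {Γ A B C} → B ∷ Γ ⊢LJ C → (A ∧̇ B) ∷ Γ ⊢LJ C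
  ∧ᵣ   : ∀ {Γ A B} → Γ ⊢LJ A → Γ ⊢LJ B → Γ ⊢LJ A ∧̇ B
  ∨ₗ   : ∀ {Γ A B C} → A ∷ Γ ⊢LJ C → B ∷ Γ ⊢LJ C → (A ∨̇ B) ∷ Γ ⊢LJ C
  ∨ᵣ¹  : ∀ {Γ A B} → Γ ⊢LJ A → Γ ⊢LJ A ∨̇ B
  ∨ᵣ²  : ∀ {Γ A B} → Γ ⊢LJ B → Γ ⊢LJ A ∨̇ B
  ⇒ₗ   : ∀ {Γ Π A B C} → Γ ⊢LJ A → B ∷ Π ⊢LJ C → (A ⇒ B) ∷ (Γ ++ Π) ⊢LJ C
  ⇒ᵣ   : ∀ {Γ A B} → A ∷ Γ ⊢LJ B → Γ ⊢LJ A ⇒ B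

module Setting (Vᵢ V꜀ : Set) where

  𝓥 : Set
  𝓥 = Vᵢ ⊎ V꜀

  KAtom : Atom 𝓥 → Set
  KAtom (aVar (inj₁ _)) = ⊥
  KAtom (aVar (inj₂ _)) = ⊤
  KAtom a𝟘              = ⊥
  KAtom a⊥              = ⊤

  IAtom : Atom 𝓥 → Set
  IAtom (aVar (inj₁ _)) = ⊤
  IAtom (aVar (inj₂ _)) = ⊥
  IAtom a𝟘              = ⊤
  IAtom a⊥              = ⊥

  𝒦 : Formula 𝓥 → Set
  𝒦 F = All KAtom (atoms F)

  ℐ : Formula 𝓥 → Set
  ℐ F = All IAtom (atoms F)

  𝒫 : Formula 𝓥 → Set
  𝒫 F = ¬ ℐ F

  open ML 𝒫 public using (_⊢_⨾_)

module Submission where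

-- From LK (resp. LJ) into
-- ML one first sends every atom outside the fragment to ⊥ (resp. 0): then
-- all formulas of a classical derivation lie in 𝒫 and can sit in the body,
-- while all formulas of an intuitionistic one lie outside 𝒫 and keep to the
-- stoup, where the ML rules are those of LK and LJ.  Conversely, forgetting
-- the stoup and reading 0 as ⊥ turns an ML derivation into an LK one, and a
-- negative translation τ, which double-negates only the subformulas outside
-- ℐ, turns a derivation of Γ ⊢ Δ ; Π into an LJ derivation of
-- τΓ, ¬τΔ ⊢ τΠ (with 0 for an empty stoup).  All these translations are the
-- identity on the respective fragments 𝒦 and ℐ.

open import Defs
open import Data.Bool using (Bool; true; false; _∧_; T)
open import Data.Bool.Properties using (T-∧; ∧-zeroʳ)
open import Data.Empty using (⊥-elim)
open import Data.List using (List; []; _∷_; _++_; map; fromMaybe)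
open import Data.List.Properties using (map-++; ++-identityʳ; map-id-local)
open import Data.List.Membership.Propositional using (_∈_)
open import Data.List.Membership.Propositional.Properties using (∈-++⁺ʳ; ∈-++⁻; ∈-∃++)
open import Data.List.Relation.Binary.Permutation.Propositional
  using (_↭_; ↭-refl; ↭-sym; ↭-trans; ↭-reflexive; prep; swap)
open import Data.List.Relation.Binary.Permutation.Propositional.Properties as ↭
  using (shift; shifts; ++-comm)
open import Data.List.Relation.Binary.Subset.Propositional using (_⊆_)
open import Data.List.Relation.Binary.Subset.Propositional.Properties as ⊆
  using (⊆-refl; ∈-∷⁺ʳ; xs⊆x∷xs; ∷⁺ʳ; xs⊆xs++ys; xs⊆ys++xs; ++⁺ʳ)
open import Data.List.Relation.Unary.All as All using (All; []; _∷_; universal)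
open import Data.List.Relation.Unary.All.Properties using (++⁺; ++⁻ˡ; ++⁻ʳ; map⁺)
open import Data.List.Relation.Unary.Any using (here; there)
open import Data.Maybe using (Maybe; just; nothing)
open import Data.Product using (∃; _×_; _,_; proj₁; proj₂)
open import Data.Sum using (inj₁; inj₂; [_,_]′)
open import Data.Unit using (⊤; tt)
open import Function using (_∘_; flip)
open import Function.Bundles using (_⇔_; mk⇔; Equivalence)
open import Relation.Binary.PropositionalEquality using (_≡_; refl; trans; cong₂; subst₂)
open import Relation.Nullary using (¬_)

++-⊆ : ∀ {A : Set} {xs ys zs : List A} → xs ⊆ zs → ys ⊆ zs → xs ++ ys ⊆ zs
++-⊆ {xs = xs} xs⊆ ys⊆ = [ xs⊆ , ys⊆ ]′ ∘ ∈-++⁻ xs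

module ⊆-Monotone {A J : Set} (Q : A → Set) (_⊢_ : List A → J → Set)
  (weaken   : ∀ {x Γ j} → Q x → Γ ⊢ j → (x ∷ Γ) ⊢ j)
  (contract : ∀ {x Γ j} → (x ∷ x ∷ Γ) ⊢ j → (x ∷ Γ) ⊢ j)
  (exchange : ∀ {Γ Γ′ j} → Γ ↭ Γ′ → Γ ⊢ j → Γ′ ⊢ j)
  where

  contract-∈ : ∀ {x Γ j} → x ∈ Γ → (x ∷ Γ) ⊢ j → Γ ⊢ j
  contract-∈ {x} x∈Γ d with ys , zs , refl ← ∈-∃++ x∈Γ =
    exchange (↭-sym (shift x ys zs)) (contract (exchange (prep x (shift x ys zs)) d))

  absorb : ∀ Δ {Γ j} → Δ ⊆ Γ → (Δ ++ Γ) ⊢ j → Γ ⊢ j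
  absorb []      _   d = d
  absorb (x ∷ Δ) sub d = absorb Δ (sub ∘ there) (contract-∈ (∈-++⁺ʳ Δ (sub (here refl))) d)

  weaken-++ : ∀ {Δ Γ j} → All Q Δ → Γ ⊢ j → (Δ ++ Γ) ⊢ j
  weaken-++ []       d = d
  weaken-++ (q ∷ qs) d = weaken q (weaken-++ qs d)

  ⊆-mono : ∀ {Γ Γ′ j} → All Q Γ′ → Γ ⊆ Γ′ → Γ ⊢ j → Γ′ ⊢ j
  ⊆-mono {Γ} {Γ′} qs sub d = absorb Γ sub (exchange (++-comm Γ′ Γ) (weaken-++ qs d))

module _ {V : Set} where

  atom : Atom V → Formula V
  atom (aVar x) = var x
  atom a𝟘       = 𝟘
  atom a⊥       = ⊥̇

  infix 8 _⟨_⟩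
  _⟨_⟩ : Formula V → (Atom V → Formula V) → Formula V
  𝟘       ⟨ σ ⟩ = σ a𝟘
  ⊥̇       ⟨ σ ⟩ = σ a⊥
  var x   ⟨ σ ⟩ = σ (aVar x)
  (A ∧̇ B) ⟨ σ ⟩ = A ⟨ σ ⟩ ∧̇ B ⟨ σ ⟩
  (A ∨̇ B) ⟨ σ ⟩ = A ⟨ σ ⟩ ∨̇ B ⟨ σ ⟩
  (A ⇒ B) ⟨ σ ⟩ = A ⟨ σ ⟩ ⇒ B ⟨ σ ⟩

  module _ {Q : Atom V → Set} {σ : Atom V → Formula V} (fix : ∀ {a} → Q a → σ a ≡ atom a) where

    ⟨σ⟩-identity : ∀ F → All Q (atoms F) → F ⟨ σ ⟩ ≡ F
    ⟨σ⟩-identity 𝟘       (q ∷ []) = fix q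
    ⟨σ⟩-identity ⊥̇       (q ∷ []) = fix q
    ⟨σ⟩-identity (var x) (q ∷ []) = fix q
    ⟨σ⟩-identity (A ∧̇ B) qs =
      cong₂ _∧̇_ (⟨σ⟩-identity A (++⁻ˡ (atoms A) qs)) (⟨σ⟩-identity B (++⁻ʳ (atoms A) qs))
    ⟨σ⟩-identity (A ∨̇ B) qs =
      cong₂ _∨̇_ (⟨σ⟩-identity A (++⁻ˡ (atoms A) qs)) (⟨σ⟩-identity B (++⁻ʳ (atoms A) qs))
    ⟨σ⟩-identity (A ⇒ B) qs =
      cong₂ _⇒_ (⟨σ⟩-identity A (++⁻ˡ (atoms A) qs)) (⟨σ⟩-identity B (++⁻ʳ (atoms A) qs))

    map-⟨σ⟩-identity : ∀ {Γ} → All (All Q ∘ atoms) Γ → map (_⟨ σ ⟩) Γ ≡ Γ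
    map-⟨σ⟩-identity = map-id-local ∘ All.map (λ {F} → ⟨σ⟩-identity F)

  All-atoms-⟨σ⟩ : ∀ {Q : Atom V → Set} {σ} → (∀ a → All Q (atoms (σ a))) → ∀ F → All Q (atoms (F ⟨ σ ⟩))
  All-atoms-⟨σ⟩ q 𝟘       = q a𝟘
  All-atoms-⟨σ⟩ q ⊥̇       = q a⊥
  All-atoms-⟨σ⟩ q (var x) = q (aVar x)
  All-atoms-⟨σ⟩ q (A ∧̇ B) = ++⁺ (All-atoms-⟨σ⟩ q A) (All-atoms-⟨σ⟩ q B)
  All-atoms-⟨σ⟩ q (A ∨̇ B) = ++⁺ (All-atoms-⟨σ⟩ q A) (All-atoms-⟨σ⟩ q B)
  All-atoms-⟨σ⟩ q (A ⇒ B) = ++⁺ (All-atoms-⟨σ⟩ q A) (All-atoms-⟨σ⟩ q B)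

  All-atoms⇒∃ : ∀ {Q : Atom V → Set} F → All Q (atoms F) → ∃ Q
  All-atoms⇒∃ 𝟘       (q ∷ []) = _ , q
  All-atoms⇒∃ ⊥̇       (q ∷ []) = _ , q
  All-atoms⇒∃ (var x) (q ∷ []) = _ , q
  All-atoms⇒∃ (A ∧̇ B) qs       = All-atoms⇒∃ A (++⁻ˡ (atoms A) qs)
  All-atoms⇒∃ (A ∨̇ B) qs       = All-atoms⇒∃ A (++⁻ˡ (atoms A) qs)
  All-atoms⇒∃ (A ⇒ B) qs       = All-atoms⇒∃ A (++⁻ˡ (atoms A) qs)

  𝟘↦⊥ : Atom V → Formula V
  𝟘↦⊥ a𝟘 = ⊥̇
  𝟘↦⊥ a  = atom a

  Zero-free-⟨𝟘↦⊥⟩ : ∀ F → Zero-free (F ⟨ 𝟘↦⊥ ⟩)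
  Zero-free-⟨𝟘↦⊥⟩ = All-atoms-⟨σ⟩ λ { (aVar _) → (λ ()) ∷ [] ; a𝟘 → (λ ()) ∷ [] ; a⊥ → (λ ()) ∷ [] }

  ⌊_⌋ : List (Formula V) → List (Formula V)
  ⌊_⌋ = map (_⟨ 𝟘↦⊥ ⟩)

  ⌊_⌋ˢ : Maybe (Formula V) → List (Formula V)
  ⌊ Π ⌋ˢ = ⌊ fromMaybe Π ⌋

  ⌊⌋-++ : ∀ Γ Γ′ → ⌊ Γ ++ Γ′ ⌋ ≡ ⌊ Γ ⌋ ++ ⌊ Γ′ ⌋
  ⌊⌋-++ = map-++ (_⟨ 𝟘↦⊥ ⟩)

  ⊆-LK : ∀ {Γ Γ′ Δ Δ′ : List (Formula V)} → Γ ⊆ Γ′ → Δ ⊆ Δ′ → Γ ⊢LK Δ → Γ′ ⊢LK Δ′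
  ⊆-LK {Γ′ = Γ′} {Δ′ = Δ′} Γ⊆ Δ⊆ = L.⊆-mono (universal _ Γ′) Γ⊆ ∘ R.⊆-mono (universal _ Δ′) Δ⊆
    where
    module L = ⊆-Monotone (λ _ → ⊤) _⊢LK_ (λ _ → wₗ) cₗ (λ p → perm p ↭-refl)
    module R = ⊆-Monotone (λ _ → ⊤) (flip _⊢LK_) (λ _ → wᵣ) cᵣ (perm ↭-refl)

  LK-∧ₗ : ∀ {A B : Formula V} {Γ Δ} → A ∷ B ∷ Γ ⊢LK Δ → (A ∧̇ B) ∷ Γ ⊢LK Δ
  LK-∧ₗ d = cₗ (∧ₗ¹ (exchange (∧ₗ² (exchange d))))
    where
    exchange : ∀ {x y : Formula V} {Γ Δ} → x ∷ y ∷ Γ ⊢LK Δ → y ∷ x ∷ Γ ⊢LK Δ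
    exchange = perm (swap _ _ ↭-refl) ↭-refl

  LK-∧ᵣ : ∀ {A B : Formula V} {Γ Γ′ Δ Δ′} →
          Γ ⊢LK A ∷ Δ → Γ′ ⊢LK B ∷ Δ′ → Γ ++ Γ′ ⊢LK (A ∧̇ B) ∷ (Δ ++ Δ′)
  LK-∧ᵣ {A} {B} {Γ} {Γ′} {Δ} {Δ′} d e =
    ∧ᵣ (⊆-LK (xs⊆xs++ys Γ Γ′) (∷⁺ʳ A (xs⊆xs++ys Δ Δ′)) d)
       (⊆-LK (xs⊆ys++xs Γ′ Γ) (∷⁺ʳ B (xs⊆ys++xs Δ′ Δ)) e)

  LK-⇒ₗ : ∀ {A B : Formula V} {Γ Γ′ Δ Δ′} → B ∷ Γ ⊢LK Δ → Γ′ ⊢LK A ∷ Δ′ → (A ⇒ B) ∷ (Γ ++ Γ′) ⊢LK Δ ++ Δ′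
  LK-⇒ₗ {Γ = Γ} {Γ′} {Δ} {Δ′} d e = perm (prep _ (++-comm Γ′ Γ)) (++-comm Δ′ Δ) (⇒ₗ e d)

  ⊆-LJ : ∀ {Γ Γ′ : List (Formula V)} {C} → Γ ⊆ Γ′ → Γ ⊢LJ C → Γ′ ⊢LJ C
  ⊆-LJ {Γ′ = Γ′} = ⊆-mono (universal _ Γ′)
    where open ⊆-Monotone (λ _ → ⊤) _⊢LJ_ (λ _ → wₗ) cₗ perm

  LJ-exchange : ∀ {x y : Formula V} {Γ C} → x ∷ y ∷ Γ ⊢LJ C → y ∷ x ∷ Γ ⊢LJ C
  LJ-exchange = perm (swap _ _ ↭-refl)

  LJ-∧ₗ : ∀ {A B : Formula V} {Γ C} → A ∷ B ∷ Γ ⊢LJ C → (A ∧̇ B) ∷ Γ ⊢LJ C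
  LJ-∧ₗ d = cₗ (∧ₗ¹ (LJ-exchange (∧ₗ² (LJ-exchange d))))

  infix 9 ~_
  ~_ : Formula V → Formula V
  ~ X = X ⇒ 𝟘

  Bot-free-~ : ∀ X → Bot-free X → Bot-free (~ X)
  Bot-free-~ _ b = ++⁺ b ((λ ()) ∷ [])

  ~-left : ∀ {X : Formula V} {Γ C} → Γ ⊢LJ X → ~ X ∷ Γ ⊢LJ C
  ~-left {Γ = Γ} d = perm (prep _ (↭-reflexive (++-identityʳ Γ))) (⇒ₗ d (zero {Γ = []}))

  ~~-intro : ∀ {X : Formula V} {Γ} → Γ ⊢LJ X → Γ ⊢LJ ~ ~ X
  ~~-intro d = ⇒ᵣ (~-left d)

  ~~-left : ∀ {X : Formula V} {Γ C} → X ∷ Γ ⊢LJ 𝟘 → ~ ~ X ∷ Γ ⊢LJ C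
  ~~-left d = ~-left (⇒ᵣ d)

  conj disj impl : Bool → Formula V → Formula V → Formula V
  conj true  X Y = X ∧̇ Y
  conj false X Y = ~ ~ X ∧̇ ~ ~ Y
  disj true  X Y = X ∨̇ Y
  disj false X Y = ~ ~ (X ∨̇ Y)
  impl true  X Y = X ⇒ Y
  impl false X Y = X ⇒ ~ ~ Y

  module _ {X Y : Formula V} where

    conj-left : ∀ b {Γ} → X ∷ Y ∷ Γ ⊢LJ 𝟘 → conj b X Y ∷ Γ ⊢LJ 𝟘
    conj-left true  d = LJ-∧ₗ d
    conj-left false d = LJ-∧ₗ (LJ-exchange (~~-left (LJ-exchange (~~-left d))))

    conj-right : ∀ b {Γ} → Γ ⊢LJ X → Γ ⊢LJ Y → Γ ⊢LJ conj b X Y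
    conj-right true  d e = ∧ᵣ d e
    conj-right false d e = ∧ᵣ (~~-intro d) (~~-intro e)

    conj-right-~~ : ∀ {b Γ} → b ≡ false → Γ ⊢LJ ~ ~ X → Γ ⊢LJ ~ ~ Y → Γ ⊢LJ conj b X Y
    conj-right-~~ refl d e = ∧ᵣ d e

    disj-left : ∀ b {Γ} → X ∷ Γ ⊢LJ 𝟘 → Y ∷ Γ ⊢LJ 𝟘 → disj b X Y ∷ Γ ⊢LJ 𝟘
    disj-left true  d e = ∨ₗ d e
    disj-left false d e = ~~-left (∨ₗ d e)

    disj-right₁ : ∀ b {Γ} → Γ ⊢LJ X → Γ ⊢LJ disj b X Y
    disj-right₁ true  d = ∨ᵣ¹ d
    disj-right₁ false d = ~~-intro (∨ᵣ¹ d)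

    disj-right₂ : ∀ b {Γ} → Γ ⊢LJ Y → Γ ⊢LJ disj b X Y
    disj-right₂ true  d = ∨ᵣ² d
    disj-right₂ false d = ~~-intro (∨ᵣ² d)

    disj-right-~₁ : ∀ {b Γ} → b ≡ false → Bot-free X → ~ X ∷ Γ ⊢LJ 𝟘 → Γ ⊢LJ disj b X Y
    disj-right-~₁ refl bf d = ⇒ᵣ (cut (Bot-free-~ X bf) (⇒ᵣ (LJ-exchange (~-left (∨ᵣ¹ ax)))) d)

    disj-right-~₂ : ∀ {b Γ} → b ≡ false → Bot-free Y → ~ Y ∷ Γ ⊢LJ 𝟘 → Γ ⊢LJ disj b X Y
    disj-right-~₂ refl bf d = ⇒ᵣ (cut (Bot-free-~ Y bf) (⇒ᵣ (LJ-exchange (~-left (∨ᵣ² ax)))) d)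

    impl-left : ∀ b {Γ Γ′} → Γ′ ⊢LJ X → Y ∷ Γ ⊢LJ 𝟘 → impl b X Y ∷ (Γ′ ++ Γ) ⊢LJ 𝟘
    impl-left true  e d = ⇒ₗ e d
    impl-left false e d = ⇒ₗ e (~~-left d)

    impl-right : ∀ b {Γ} → X ∷ Γ ⊢LJ Y → Γ ⊢LJ impl b X Y
    impl-right true  d = ⇒ᵣ d
    impl-right false d = ⇒ᵣ (~~-intro d)

    impl-right-~ : ∀ {b Γ} → b ≡ false → X ∷ ~ Y ∷ Γ ⊢LJ 𝟘 → Γ ⊢LJ impl b X Y
    impl-right-~ refl d = ⇒ᵣ (⇒ᵣ (LJ-exchange d))

module _ {V : Set} {P : Formula V → Set} where
  open ML P

  ⊆-ML : ∀ {Γ Γ′ Δ Δ′ Π} → All P Δ′ → Γ ⊆ Γ′ → Δ ⊆ Δ′ → Γ ⊢ Δ ⨾ Π → Γ′ ⊢ Δ′ ⨾ Π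
  ⊆-ML {Γ′ = Γ′} ps Γ⊆ Δ⊆ = L.⊆-mono (universal _ Γ′) Γ⊆ ∘ R.⊆-mono ps Δ⊆
    where
    module L = ⊆-Monotone {J = List (Formula V) × Maybe (Formula V)} (λ _ → ⊤)
      (λ Γ j → Γ ⊢ proj₁ j ⨾ proj₂ j) (λ _ → wₗ) cₗ (λ p → perm p ↭-refl)
    module R = ⊆-Monotone {J = List (Formula V) × Maybe (Formula V)} P
      (λ Δ j → proj₁ j ⊢ Δ ⨾ proj₂ j) wᵣ cᵣ (perm ↭-refl)

  ML-exchange : ∀ {x y Γ Δ Π} → x ∷ y ∷ Γ ⊢ Δ ⨾ Π → y ∷ x ∷ Γ ⊢ Δ ⨾ Π
  ML-exchange = perm (swap _ _ ↭-refl) ↭-refl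

  body-All : ∀ {Γ Δ Π} → Γ ⊢ Δ ⨾ Π → All P Δ
  body-All ax            = []
  body-All (cut₁ d e)    = ++⁺ (body-All d) (body-All e)
  body-All (cut₂ d e)    = ++⁺ (All.tail (body-All d)) (body-All e)
  body-All (der p d)     = p ∷ body-All d
  body-All (cₗ d)        = body-All d
  body-All (cᵣ d)        = All.tail (body-All d)
  body-All (wₗ d)        = body-All d
  body-All (wᵣ p d)      = p ∷ body-All d
  body-All (perm _ q d)  = ↭.All-resp-↭ q (body-All d)
  body-All (zero ps)     = ps
  body-All bot           = []
  body-All (∧ₗ¹ _ _ d)   = body-All d
  body-All (∧ₗ² d)       = body-All d
  body-All (∧ᵣ¹ d e)     = ++⁺ (body-All d) (body-All e)
  body-All (∧ᵣ² d e)     = ++⁺ (All.tail (body-All d)) (All.tail (body-All e))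
  body-All (∧ᵣ³ d e)     = ++⁺ (body-All d) (All.tail (body-All e))
  body-All (∧ᵣ⁴ d e)     = ++⁺ (All.tail (body-All d)) (body-All e)
  body-All (∨ₗ¹ _ _ d _) = body-All d
  body-All (∨ₗ² d _)     = body-All d
  body-All (∨ᵣ¹ d)       = body-All d
  body-All (∨ᵣ² d)       = body-All d
  body-All (∨ᵣ³ d)       = All.tail (body-All d)
  body-All (∨ᵣ⁴ d)       = All.tail (body-All d)
  body-All (⇒ₗ¹ _ d e)   = ++⁺ (body-All d) (body-All e)
  body-All (⇒ₗ² d e)     = ++⁺ (body-All d) (body-All e)
  body-All (⇒ₗ³ d e)     = ++⁺ (body-All d) (All.tail (body-All e))
  body-All (⇒ᵣ¹ d)       = body-All d
  body-All (⇒ᵣ² d)       = All.tail (body-All d)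

  body-head : ∀ {Γ A Δ Π} → Γ ⊢ A ∷ Δ ⨾ Π → P A
  body-head = All.head ∘ body-All

  ML⇒LK : ∀ {Γ Δ Π} → Γ ⊢ Δ ⨾ Π → ⌊ Γ ⌋ ⊢LK ⌊ Π ⌋ˢ ++ ⌊ Δ ⌋
  ML⇒LK ax = ax
  ML⇒LK (cut₁ {Γ} {Γ′} {Δ} {Δ′} {A} {Π} d e) rewrite ⌊⌋-++ Γ Γ′ | ⌊⌋-++ Δ Δ′ =
    perm ↭-refl (shifts ⌊ Δ ⌋ ⌊ Π ⌋ˢ) (cut (Zero-free-⟨𝟘↦⊥⟩ A) (ML⇒LK d) (ML⇒LK e))
  ML⇒LK (cut₂ {Γ} {Γ′} {Δ} {Δ′} {A} {Π} d e) rewrite ⌊⌋-++ Γ Γ′ | ⌊⌋-++ Δ Δ′ =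
    perm ↭-refl (↭.++-assoc ⌊ Π ⌋ˢ ⌊ Δ ⌋ ⌊ Δ′ ⌋)
      (cut (Zero-free-⟨𝟘↦⊥⟩ A) (perm ↭-refl (shift _ ⌊ Π ⌋ˢ ⌊ Δ ⌋) (ML⇒LK d)) (ML⇒LK e))
  ML⇒LK (der _ d) = ML⇒LK d
  ML⇒LK (cₗ d) = cₗ (ML⇒LK d)
  ML⇒LK (cᵣ {Π = Π} d) = ⊆-LK ⊆-refl (++⁺ʳ ⌊ Π ⌋ˢ (∈-∷⁺ʳ (here refl) ⊆-refl)) (ML⇒LK d)
  ML⇒LK (wₗ d) = wₗ (ML⇒LK d)
  ML⇒LK (wᵣ {Δ = Δ} {Π = Π} _ d) = ⊆-LK ⊆-refl (++⁺ʳ ⌊ Π ⌋ˢ (xs⊆x∷xs ⌊ Δ ⌋ _)) (ML⇒LK d)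
  ML⇒LK (perm {Π = Π} p q d) = perm (↭.map⁺ _ p) (↭.++⁺ˡ ⌊ Π ⌋ˢ (↭.map⁺ _ q)) (ML⇒LK d)
  ML⇒LK (zero _) = ⊆-LK (∷⁺ʳ ⊥̇ (λ ())) (λ ()) bot
  ML⇒LK bot = bot
  ML⇒LK (∧ₗ¹ _ _ d) = LK-∧ₗ (ML⇒LK d)
  ML⇒LK (∧ₗ² d) = LK-∧ₗ (ML⇒LK d)
  ML⇒LK (∧ᵣ¹ {Γ} {Γ′} {Δ} {Δ′} d e) rewrite ⌊⌋-++ Γ Γ′ | ⌊⌋-++ Δ Δ′ = LK-∧ᵣ (ML⇒LK d) (ML⇒LK e)
  ML⇒LK (∧ᵣ² {Γ} {Γ′} {Δ} {Δ′} d e) rewrite ⌊⌋-++ Γ Γ′ | ⌊⌋-++ Δ Δ′ = LK-∧ᵣ (ML⇒LK d) (ML⇒LK e)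
  ML⇒LK (∧ᵣ³ {Γ} {Γ′} {Δ} {Δ′} d e) rewrite ⌊⌋-++ Γ Γ′ | ⌊⌋-++ Δ Δ′ = LK-∧ᵣ (ML⇒LK d) (ML⇒LK e)
  ML⇒LK (∧ᵣ⁴ {Γ} {Γ′} {Δ} {Δ′} d e) rewrite ⌊⌋-++ Γ Γ′ | ⌊⌋-++ Δ Δ′ = LK-∧ᵣ (ML⇒LK d) (ML⇒LK e)
  ML⇒LK (∨ₗ¹ _ _ d e) = ∨ₗ (ML⇒LK d) (ML⇒LK e)
  ML⇒LK (∨ₗ² d e) = ∨ₗ (ML⇒LK d) (ML⇒LK e)
  ML⇒LK (∨ᵣ¹ d) = ∨ᵣ¹ (ML⇒LK d)
  ML⇒LK (∨ᵣ² d) = ∨ᵣ² (ML⇒LK d)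
  ML⇒LK (∨ᵣ³ d) = ∨ᵣ¹ (ML⇒LK d)
  ML⇒LK (∨ᵣ⁴ d) = ∨ᵣ² (ML⇒LK d)
  ML⇒LK (⇒ₗ¹ {Γ} {Γ′} {Δ} {Δ′} _ d e) rewrite ⌊⌋-++ Γ Γ′ | ⌊⌋-++ Δ Δ′ = LK-⇒ₗ (ML⇒LK d) (ML⇒LK e)
  ML⇒LK (⇒ₗ² {Γ} {Γ′} {Δ} {Δ′} d e) rewrite ⌊⌋-++ Γ Γ′ | ⌊⌋-++ Δ Δ′ = LK-⇒ₗ (ML⇒LK d) (ML⇒LK e)
  ML⇒LK (⇒ₗ³ {Γ} {Γ′} {Δ} {Δ′} {Π = Π} d e) rewrite ⌊⌋-++ Γ Γ′ | ⌊⌋-++ Δ Δ′ =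
    perm ↭-refl (shifts ⌊ Δ ⌋ ⌊ Π ⌋ˢ) (LK-⇒ₗ (ML⇒LK d) (perm ↭-refl (shift _ ⌊ Π ⌋ˢ ⌊ Δ′ ⌋) (ML⇒LK e)))
  ML⇒LK (⇒ᵣ¹ d) = ⇒ᵣ (ML⇒LK d)
  ML⇒LK (⇒ᵣ² d) = ⇒ᵣ (ML⇒LK d)

module Fragments (Vᵢ V꜀ : Set) where
  open Setting Vᵢ V꜀
  open ML 𝒫 hiding (_⊢_⨾_)

  KAtom⇒¬IAtom : ∀ a → KAtom a → ¬ IAtom a
  KAtom⇒¬IAtom (aVar (inj₁ _)) ()
  KAtom⇒¬IAtom (aVar (inj₂ _)) _ ()
  KAtom⇒¬IAtom a𝟘              ()
  KAtom⇒¬IAtom a⊥              _ ()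

  𝒦⇒𝒫 : ∀ F → 𝒦 F → 𝒫 F
  𝒦⇒𝒫 F k i with a , ka , ia ← All-atoms⇒∃ F (All.zip (k , i)) = KAtom⇒¬IAtom a ka ia

  ℐ⇒Bot-free : ∀ {F} → ℐ F → Bot-free F
  ℐ⇒Bot-free = All.map λ { {aVar (inj₁ _)} _ () ; {a𝟘} _ () }

  σ𝒦 : Atom 𝓥 → Formula 𝓥
  σ𝒦 (aVar (inj₂ y)) = var (inj₂ y)
  σ𝒦 _               = ⊥̇

  σ𝒦* : List (Formula 𝓥) → List (Formula 𝓥)
  σ𝒦* = map (_⟨ σ𝒦 ⟩)

  σ𝒦*-++ : ∀ Γ Γ′ → σ𝒦* (Γ ++ Γ′) ≡ σ𝒦* Γ ++ σ𝒦* Γ′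
  σ𝒦*-++ = map-++ (_⟨ σ𝒦 ⟩)

  𝒫-⟨σ𝒦⟩ : ∀ F → 𝒫 (F ⟨ σ𝒦 ⟩)
  𝒫-⟨σ𝒦⟩ F = 𝒦⇒𝒫 (F ⟨ σ𝒦 ⟩) (All-atoms-⟨σ⟩ 𝒦-σ𝒦 F)
    where
    𝒦-σ𝒦 : ∀ a → 𝒦 (σ𝒦 a)
    𝒦-σ𝒦 (aVar (inj₁ _)) = tt ∷ []
    𝒦-σ𝒦 (aVar (inj₂ _)) = tt ∷ []
    𝒦-σ𝒦 a𝟘              = tt ∷ []
    𝒦-σ𝒦 a⊥              = tt ∷ []

  𝒫-σ𝒦* : ∀ Δ → All 𝒫 (σ𝒦* Δ)
  𝒫-σ𝒦* Δ = map⁺ (universal 𝒫-⟨σ𝒦⟩ Δ)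

  σ𝒦-fixes-𝒦 : ∀ {Γ} → All 𝒦 Γ → σ𝒦* Γ ≡ Γ
  σ𝒦-fixes-𝒦 = map-⟨σ⟩-identity λ { {aVar (inj₂ _)} _ → refl ; {a⊥} _ → refl }

  𝟘↦⊥-fixes-𝒦 : ∀ {Γ} → All 𝒦 Γ → ⌊ Γ ⌋ ≡ Γ
  𝟘↦⊥-fixes-𝒦 = map-⟨σ⟩-identity λ { {aVar (inj₂ _)} _ → refl ; {a⊥} _ → refl }

  LK⇒ML : ∀ {Γ Δ} → Γ ⊢LK Δ → σ𝒦* Γ ⊢ σ𝒦* Δ ⨾ nothing
  LK⇒ML (ax {A}) = der (𝒫-⟨σ𝒦⟩ A) ax
  LK⇒ML (cut {Γ} {Π} {Δ} {Λ} _ d e) rewrite σ𝒦*-++ Γ Π | σ𝒦*-++ Δ Λ = cut₂ (LK⇒ML d) (LK⇒ML e)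
  LK⇒ML (wₗ d) = wₗ (LK⇒ML d)
  LK⇒ML (wᵣ {A = A} d) = wᵣ (𝒫-⟨σ𝒦⟩ A) (LK⇒ML d)
  LK⇒ML (cₗ d) = cₗ (LK⇒ML d)
  LK⇒ML (cᵣ d) = cᵣ (LK⇒ML d)
  LK⇒ML (perm p q d) = perm (↭.map⁺ _ p) (↭.map⁺ _ q) (LK⇒ML d)
  LK⇒ML bot = bot
  LK⇒ML (∧ₗ¹ d) = ∧ₗ² (ML-exchange (wₗ (LK⇒ML d)))
  LK⇒ML (∧ₗ² d) = ∧ₗ² (wₗ (LK⇒ML d))
  LK⇒ML (∧ᵣ {Δ = Δ} {A} {B} d e) =
    ⊆-ML (𝒫-σ𝒦* ((A ∧̇ B) ∷ Δ)) (++-⊆ ⊆-refl ⊆-refl) (∷⁺ʳ _ (++-⊆ ⊆-refl ⊆-refl))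
      (der (𝒫-⟨σ𝒦⟩ (A ∧̇ B)) (∧ᵣ² (LK⇒ML d) (LK⇒ML e)))
  LK⇒ML (∨ₗ d e) = ∨ₗ² (LK⇒ML d) (LK⇒ML e)
  LK⇒ML (∨ᵣ¹ {A = A} {B} d) = der (𝒫-⟨σ𝒦⟩ (A ∨̇ B)) (∨ᵣ³ (LK⇒ML d))
  LK⇒ML (∨ᵣ² {A = A} {B} d) = der (𝒫-⟨σ𝒦⟩ (A ∨̇ B)) (∨ᵣ⁴ (LK⇒ML d))
  LK⇒ML (⇒ₗ {Γ} {Π} {Δ} {Λ} d e) rewrite σ𝒦*-++ Γ Π | σ𝒦*-++ Δ Λ =
    perm (prep _ (++-comm (σ𝒦* Π) (σ𝒦* Γ))) (++-comm (σ𝒦* Λ) (σ𝒦* Δ)) (⇒ₗ³ (LK⇒ML e) (LK⇒ML d))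
  LK⇒ML (⇒ᵣ {A = A} {B} d) = der (𝒫-⟨σ𝒦⟩ (A ⇒ B)) (⇒ᵣ² (LK⇒ML d))

  ⊢⇔⊢LK : ∀ Γ Δ → All 𝒦 Γ → All 𝒦 Δ → (Γ ⊢ Δ ⨾ nothing) ⇔ (Γ ⊢LK Δ)
  ⊢⇔⊢LK Γ Δ kΓ kΔ = mk⇔
    (λ d → subst₂ _⊢LK_ (𝟘↦⊥-fixes-𝒦 kΓ) (𝟘↦⊥-fixes-𝒦 kΔ) (ML⇒LK d))
    (λ d → subst₂ (λ Γ′ Δ′ → Γ′ ⊢ Δ′ ⨾ nothing) (σ𝒦-fixes-𝒦 kΓ) (σ𝒦-fixes-𝒦 kΔ) (LK⇒ML d))

  σℐ : Atom 𝓥 → Formula 𝓥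
  σℐ (aVar (inj₁ x)) = var (inj₁ x)
  σℐ _               = 𝟘

  σℐ* : List (Formula 𝓥) → List (Formula 𝓥)
  σℐ* = map (_⟨ σℐ ⟩)

  σℐ*-++ : ∀ Γ Γ′ → σℐ* (Γ ++ Γ′) ≡ σℐ* Γ ++ σℐ* Γ′
  σℐ*-++ = map-++ (_⟨ σℐ ⟩)

  ¬𝒫-⟨σℐ⟩ : ∀ F → ¬ 𝒫 (F ⟨ σℐ ⟩)
  ¬𝒫-⟨σℐ⟩ F p = p (All-atoms-⟨σ⟩ ℐ-σℐ F)
    where
    ℐ-σℐ : ∀ a → ℐ (σℐ a)
    ℐ-σℐ (aVar (inj₁ _)) = tt ∷ []
    ℐ-σℐ (aVar (inj₂ _)) = tt ∷ []
    ℐ-σℐ a𝟘              = tt ∷ []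
    ℐ-σℐ a⊥              = tt ∷ []

  σℐ-fixes-IAtom : ∀ {a} → IAtom a → σℐ a ≡ atom a
  σℐ-fixes-IAtom {aVar (inj₁ _)} _ = refl
  σℐ-fixes-IAtom {a𝟘}            _ = refl

  LJ⇒ML : ∀ {Γ C} → Γ ⊢LJ C → σℐ* Γ ⊢ [] ⨾ just (C ⟨ σℐ ⟩)
  LJ⇒ML ax = ax
  LJ⇒ML (cut {Γ} {Π} _ d e) rewrite σℐ*-++ Γ Π = cut₁ (LJ⇒ML d) (LJ⇒ML e)
  LJ⇒ML (wₗ d) = wₗ (LJ⇒ML d)
  LJ⇒ML (cₗ d) = cₗ (LJ⇒ML d)
  LJ⇒ML (perm p d) = perm (↭.map⁺ _ p) ↭-refl (LJ⇒ML d)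
  LJ⇒ML zero = zero []
  LJ⇒ML (∧ₗ¹ {A = A} {B} d) = ∧ₗ¹ (¬𝒫-⟨σℐ⟩ A) (¬𝒫-⟨σℐ⟩ B) (ML-exchange (wₗ (LJ⇒ML d)))
  LJ⇒ML (∧ₗ² {A = A} {B} d) = ∧ₗ¹ (¬𝒫-⟨σℐ⟩ A) (¬𝒫-⟨σℐ⟩ B) (wₗ (LJ⇒ML d))
  LJ⇒ML (∧ᵣ d e) = ⊆-ML [] (++-⊆ ⊆-refl ⊆-refl) ⊆-refl (∧ᵣ¹ (LJ⇒ML d) (LJ⇒ML e))
  LJ⇒ML (∨ₗ {A = A} {B} d e) = ∨ₗ¹ (¬𝒫-⟨σℐ⟩ A) (¬𝒫-⟨σℐ⟩ B) (LJ⇒ML d) (LJ⇒ML e)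
  LJ⇒ML (∨ᵣ¹ d) = ∨ᵣ¹ (LJ⇒ML d)
  LJ⇒ML (∨ᵣ² d) = ∨ᵣ² (LJ⇒ML d)
  LJ⇒ML (⇒ₗ {Γ} {Π} {B = B} d e) rewrite σℐ*-++ Γ Π =
    perm (prep _ (++-comm (σℐ* Π) (σℐ* Γ))) ↭-refl (⇒ₗ¹ (¬𝒫-⟨σℐ⟩ B) (LJ⇒ML e) (LJ⇒ML d))
  LJ⇒ML (⇒ᵣ d) = ⇒ᵣ¹ (LJ⇒ML d)

  is-ℐ : Formula 𝓥 → Bool
  is-ℐ 𝟘              = true
  is-ℐ ⊥̇              = false
  is-ℐ (var (inj₁ _)) = true
  is-ℐ (var (inj₂ _)) = false
  is-ℐ (A ∧̇ B)        = is-ℐ A ∧ is-ℐ B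
  is-ℐ (A ∨̇ B)        = is-ℐ A ∧ is-ℐ B
  is-ℐ (A ⇒ B)        = is-ℐ A ∧ is-ℐ B

  is-ℐ-sound : ∀ F → T (is-ℐ F) → ℐ F
  is-ℐ-sound 𝟘              _ = tt ∷ []
  is-ℐ-sound (var (inj₁ _)) _ = tt ∷ []
  is-ℐ-sound (A ∧̇ B) t = let a , b = Equivalence.to T-∧ t in ++⁺ (is-ℐ-sound A a) (is-ℐ-sound B b)
  is-ℐ-sound (A ∨̇ B) t = let a , b = Equivalence.to T-∧ t in ++⁺ (is-ℐ-sound A a) (is-ℐ-sound B b)
  is-ℐ-sound (A ⇒ B) t = let a , b = Equivalence.to T-∧ t in ++⁺ (is-ℐ-sound A a) (is-ℐ-sound B b)

  is-ℐ-complete : ∀ F → ℐ F → T (is-ℐ F)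
  is-ℐ-complete 𝟘              _ = tt
  is-ℐ-complete ⊥̇              (() ∷ [])
  is-ℐ-complete (var (inj₁ _)) _ = tt
  is-ℐ-complete (var (inj₂ _)) (() ∷ [])
  is-ℐ-complete (A ∧̇ B) i =
    Equivalence.from T-∧ (is-ℐ-complete A (++⁻ˡ (atoms A) i) , is-ℐ-complete B (++⁻ʳ (atoms A) i))
  is-ℐ-complete (A ∨̇ B) i =
    Equivalence.from T-∧ (is-ℐ-complete A (++⁻ˡ (atoms A) i) , is-ℐ-complete B (++⁻ʳ (atoms A) i))
  is-ℐ-complete (A ⇒ B) i =
    Equivalence.from T-∧ (is-ℐ-complete A (++⁻ˡ (atoms A) i) , is-ℐ-complete B (++⁻ʳ (atoms A) i))

  ¬𝒫⇒is-ℐ≡true : ∀ F → ¬ 𝒫 F → is-ℐ F ≡ true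
  ¬𝒫⇒is-ℐ≡true F ¬p with is-ℐ F | is-ℐ-complete F
  ... | true  | _ = refl
  ... | false | c = ⊥-elim (¬p c)

  𝒫⇒is-ℐ≡false : ∀ F → 𝒫 F → is-ℐ F ≡ false
  𝒫⇒is-ℐ≡false F p with is-ℐ F | is-ℐ-sound F
  ... | true  | s = ⊥-elim (p (s tt))
  ... | false | _ = refl

  ℐ⇒is-ℐ≡true : ∀ F → ℐ F → is-ℐ F ≡ true
  ℐ⇒is-ℐ≡true F i = ¬𝒫⇒is-ℐ≡true F (λ p → p i)

  𝒫ˡ⇒is-ℐ≡false : ∀ A B → 𝒫 A → is-ℐ A ∧ is-ℐ B ≡ false
  𝒫ˡ⇒is-ℐ≡false A B p rewrite 𝒫⇒is-ℐ≡false A p = refl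

  𝒫ʳ⇒is-ℐ≡false : ∀ A B → 𝒫 B → is-ℐ A ∧ is-ℐ B ≡ false
  𝒫ʳ⇒is-ℐ≡false A B p rewrite 𝒫⇒is-ℐ≡false B p = ∧-zeroʳ (is-ℐ A)

  -- The flag of each connective records whether the formula (for ⇒, its
  -- consequent) lies in ℐ; only outside ℐ are double negations inserted.
  τ : Formula 𝓥 → Formula 𝓥
  τ 𝟘              = 𝟘
  τ ⊥̇              = 𝟘
  τ (var (inj₁ x)) = var (inj₁ x)
  τ (var (inj₂ _)) = 𝟘
  τ (A ∧̇ B)        = conj (is-ℐ (A ∧̇ B)) (τ A) (τ B)
  τ (A ∨̇ B)        = disj (is-ℐ (A ∨̇ B)) (τ A) (τ B)
  τ (A ⇒ B)        = impl (is-ℐ B) (τ A) (τ B)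

  Bot-free-τ : ∀ F → Bot-free (τ F)
  Bot-free-τ F = ℐ⇒Bot-free {τ F} (τ-ℐ F)
    where
    ~~-ℐ : ∀ X → ℐ X → ℐ (~ ~ X)
    ~~-ℐ X i = ++⁺ (++⁺ i (tt ∷ [])) (tt ∷ [])

    τ-ℐ : ∀ F → ℐ (τ F)
    τ-ℐ 𝟘              = tt ∷ []
    τ-ℐ ⊥̇              = tt ∷ []
    τ-ℐ (var (inj₁ _)) = tt ∷ []
    τ-ℐ (var (inj₂ _)) = tt ∷ []
    τ-ℐ (A ∧̇ B) with is-ℐ (A ∧̇ B)
    ... | true  = ++⁺ (τ-ℐ A) (τ-ℐ B)
    ... | false = ++⁺ (~~-ℐ (τ A) (τ-ℐ A)) (~~-ℐ (τ B) (τ-ℐ B))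
    τ-ℐ (A ∨̇ B) with is-ℐ (A ∨̇ B)
    ... | true  = ++⁺ (τ-ℐ A) (τ-ℐ B)
    ... | false = ~~-ℐ (τ A ∨̇ τ B) (++⁺ (τ-ℐ A) (τ-ℐ B))
    τ-ℐ (A ⇒ B) with is-ℐ B
    ... | true  = ++⁺ (τ-ℐ A) (τ-ℐ B)
    ... | false = ++⁺ (τ-ℐ A) (~~-ℐ (τ B) (τ-ℐ B))

  τ-fixes-ℐ : ∀ F → ℐ F → τ F ≡ F
  τ-fixes-ℐ 𝟘              _ = refl
  τ-fixes-ℐ ⊥̇              (() ∷ [])
  τ-fixes-ℐ (var (inj₁ _)) _ = refl
  τ-fixes-ℐ (var (inj₂ _)) (() ∷ [])
  τ-fixes-ℐ (A ∧̇ B) i rewrite ℐ⇒is-ℐ≡true A (++⁻ˡ (atoms A) i) | ℐ⇒is-ℐ≡true B (++⁻ʳ (atoms A) i) =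
    cong₂ _∧̇_ (τ-fixes-ℐ A (++⁻ˡ (atoms A) i)) (τ-fixes-ℐ B (++⁻ʳ (atoms A) i))
  τ-fixes-ℐ (A ∨̇ B) i rewrite ℐ⇒is-ℐ≡true A (++⁻ˡ (atoms A) i) | ℐ⇒is-ℐ≡true B (++⁻ʳ (atoms A) i) =
    cong₂ _∨̇_ (τ-fixes-ℐ A (++⁻ˡ (atoms A) i)) (τ-fixes-ℐ B (++⁻ʳ (atoms A) i))
  τ-fixes-ℐ (A ⇒ B) i rewrite ℐ⇒is-ℐ≡true B (++⁻ʳ (atoms A) i) =
    cong₂ _⇒_ (τ-fixes-ℐ A (++⁻ˡ (atoms A) i)) (τ-fixes-ℐ B (++⁻ʳ (atoms A) i))

  ⟦_⨾_⟧ : List (Formula 𝓥) → List (Formula 𝓥) → List (Formula 𝓥)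
  ⟦ Γ ⨾ Δ ⟧ = map τ Γ ++ map (~_ ∘ τ) Δ

  ⟦_⟧ˢ : Maybe (Formula 𝓥) → Formula 𝓥
  ⟦ nothing ⟧ˢ = 𝟘
  ⟦ just C  ⟧ˢ = τ C

  ⟦⟧-mono : ∀ {Γ Γ′ Δ Δ′} → Γ ⊆ Γ′ → Δ ⊆ Δ′ → ⟦ Γ ⨾ Δ ⟧ ⊆ ⟦ Γ′ ⨾ Δ′ ⟧
  ⟦⟧-mono Γ⊆ Δ⊆ = ⊆.++⁺ (⊆.map⁺ τ Γ⊆) (⊆.map⁺ (~_ ∘ τ) Δ⊆)

  ⟦⟧-↭ : ∀ {Γ Γ′ Δ Δ′} → Γ ↭ Γ′ → Δ ↭ Δ′ → ⟦ Γ ⨾ Δ ⟧ ↭ ⟦ Γ′ ⨾ Δ′ ⟧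
  ⟦⟧-↭ Γ↭ Δ↭ = ↭.++⁺ (↭.map⁺ τ Γ↭) (↭.map⁺ (~_ ∘ τ) Δ↭)

  ⟦⟧-body-∷ : ∀ Γ Δ A → ⟦ Γ ⨾ A ∷ Δ ⟧ ↭ ~ τ A ∷ ⟦ Γ ⨾ Δ ⟧
  ⟦⟧-body-∷ Γ Δ A = shift (~ τ A) (map τ Γ) (map (~_ ∘ τ) Δ)

  module _ (Γ Γ′ Δ Δ′ : List (Formula 𝓥)) where

    ⟦⟧-⊆ˡ : ⟦ Γ ⨾ Δ ⟧ ⊆ ⟦ Γ ++ Γ′ ⨾ Δ ++ Δ′ ⟧
    ⟦⟧-⊆ˡ = ⟦⟧-mono (xs⊆xs++ys Γ Γ′) (xs⊆xs++ys Δ Δ′)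

    ⟦⟧-⊆ʳ : ⟦ Γ′ ⨾ Δ′ ⟧ ⊆ ⟦ Γ ++ Γ′ ⨾ Δ ++ Δ′ ⟧
    ⟦⟧-⊆ʳ = ⟦⟧-mono (xs⊆ys++xs Γ′ Γ) (xs⊆ys++xs Δ′ Δ)

    ⟦⟧-++ : ⟦ Γ ⨾ Δ ⟧ ++ ⟦ Γ′ ⨾ Δ′ ⟧ ⊆ ⟦ Γ ++ Γ′ ⨾ Δ ++ Δ′ ⟧
    ⟦⟧-++ = ++-⊆ ⟦⟧-⊆ˡ ⟦⟧-⊆ʳ

    ⟦⟧-++-comm : ⟦ Γ′ ⨾ Δ′ ⟧ ++ ⟦ Γ ⨾ Δ ⟧ ⊆ ⟦ Γ ++ Γ′ ⨾ Δ ++ Δ′ ⟧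
    ⟦⟧-++-comm = ++-⊆ ⟦⟧-⊆ʳ ⟦⟧-⊆ˡ

  body⇒~~ : ∀ Γ Δ A → ⟦ Γ ⨾ A ∷ Δ ⟧ ⊢LJ 𝟘 → ⟦ Γ ⨾ Δ ⟧ ⊢LJ ~ ~ τ A
  body⇒~~ Γ Δ A d = ⇒ᵣ (perm (⟦⟧-body-∷ Γ Δ A) d)

  ML⇒LJ : ∀ {Γ Δ Π} → Γ ⊢ Δ ⨾ Π → ⟦ Γ ⨾ Δ ⟧ ⊢LJ ⟦ Π ⟧ˢ
  ML⇒LJ ax = ax
  ML⇒LJ (cut₁ {Γ} {Γ′} {Δ} {Δ′} {A} d e) =
    ⊆-LJ (⟦⟧-++ Γ Γ′ Δ Δ′) (cut (Bot-free-τ A) (ML⇒LJ d) (ML⇒LJ e))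
  ML⇒LJ (cut₂ {Γ} {Γ′} {Δ} {Δ′} {A} d e) =
    ⊆-LJ (⟦⟧-++-comm Γ Γ′ Δ Δ′)
      (cut (Bot-free-~ (τ A) (Bot-free-τ A)) (⇒ᵣ (ML⇒LJ e)) (perm (⟦⟧-body-∷ Γ Δ A) (ML⇒LJ d)))
  ML⇒LJ (der {Γ} {Δ} {A} _ d) = perm (↭-sym (⟦⟧-body-∷ Γ Δ A)) (~-left (ML⇒LJ d))
  ML⇒LJ (cₗ d) = cₗ (ML⇒LJ d)
  ML⇒LJ (cᵣ {Γ} {Δ} {A} d) =
    perm (↭-sym (⟦⟧-body-∷ Γ Δ A))
      (cₗ (perm (↭-trans (⟦⟧-body-∷ Γ (A ∷ Δ) A) (prep _ (⟦⟧-body-∷ Γ Δ A))) (ML⇒LJ d)))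
  ML⇒LJ (wₗ d) = wₗ (ML⇒LJ d)
  ML⇒LJ (wᵣ {Γ} {Δ} {A} _ d) = perm (↭-sym (⟦⟧-body-∷ Γ Δ A)) (wₗ (ML⇒LJ d))
  ML⇒LJ (perm p q d) = perm (⟦⟧-↭ p q) (ML⇒LJ d)
  ML⇒LJ (zero _) = zero
  ML⇒LJ bot = zero
  ML⇒LJ (∧ₗ¹ {A = A} {B} ¬pA ¬pB d) rewrite ¬𝒫⇒is-ℐ≡true A ¬pA | ¬𝒫⇒is-ℐ≡true B ¬pB =
    LJ-∧ₗ (ML⇒LJ d)
  ML⇒LJ (∧ₗ² {A = A} {B} d) = conj-left (is-ℐ (A ∧̇ B)) (ML⇒LJ d)
  ML⇒LJ (∧ᵣ¹ {Γ} {Γ′} {Δ} {Δ′} {A} {B} d e) =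
    conj-right (is-ℐ (A ∧̇ B))
      (⊆-LJ (⟦⟧-⊆ˡ Γ Γ′ Δ Δ′) (ML⇒LJ d)) (⊆-LJ (⟦⟧-⊆ʳ Γ Γ′ Δ Δ′) (ML⇒LJ e))
  ML⇒LJ (∧ᵣ² {Γ} {Γ′} {Δ} {Δ′} {A} {B} d e) =
    conj-right-~~ (𝒫ˡ⇒is-ℐ≡false A B (body-head d))
      (⊆-LJ (⟦⟧-⊆ˡ Γ Γ′ Δ Δ′) (body⇒~~ Γ Δ A (ML⇒LJ d)))
      (⊆-LJ (⟦⟧-⊆ʳ Γ Γ′ Δ Δ′) (body⇒~~ Γ′ Δ′ B (ML⇒LJ e)))
  ML⇒LJ (∧ᵣ³ {Γ} {Γ′} {Δ} {Δ′} {A} {B} d e) =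
    conj-right-~~ (𝒫ʳ⇒is-ℐ≡false A B (body-head e))
      (⊆-LJ (⟦⟧-⊆ˡ Γ Γ′ Δ Δ′) (~~-intro (ML⇒LJ d)))
      (⊆-LJ (⟦⟧-⊆ʳ Γ Γ′ Δ Δ′) (body⇒~~ Γ′ Δ′ B (ML⇒LJ e)))
  ML⇒LJ (∧ᵣ⁴ {Γ} {Γ′} {Δ} {Δ′} {A} {B} d e) =
    conj-right-~~ (𝒫ˡ⇒is-ℐ≡false A B (body-head d))
      (⊆-LJ (⟦⟧-⊆ˡ Γ Γ′ Δ Δ′) (body⇒~~ Γ Δ A (ML⇒LJ d)))
      (⊆-LJ (⟦⟧-⊆ʳ Γ Γ′ Δ Δ′) (~~-intro (ML⇒LJ e)))
  ML⇒LJ (∨ₗ¹ {A = A} {B} ¬pA ¬pB d e) rewrite ¬𝒫⇒is-ℐ≡true A ¬pA | ¬𝒫⇒is-ℐ≡true B ¬pB =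
    ∨ₗ (ML⇒LJ d) (ML⇒LJ e)
  ML⇒LJ (∨ₗ² {A = A} {B} d e) = disj-left (is-ℐ (A ∨̇ B)) (ML⇒LJ d) (ML⇒LJ e)
  ML⇒LJ (∨ᵣ¹ {A = A} {B} d) = disj-right₁ (is-ℐ (A ∨̇ B)) (ML⇒LJ d)
  ML⇒LJ (∨ᵣ² {A = A} {B} d) = disj-right₂ (is-ℐ (A ∨̇ B)) (ML⇒LJ d)
  ML⇒LJ (∨ᵣ³ {Γ} {Δ} {A} {B} d) =
    disj-right-~₁ (𝒫ˡ⇒is-ℐ≡false A B (body-head d)) (Bot-free-τ A) (perm (⟦⟧-body-∷ Γ Δ A) (ML⇒LJ d))
  ML⇒LJ (∨ᵣ⁴ {Γ} {Δ} {A} {B} d) =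
    disj-right-~₂ (𝒫ʳ⇒is-ℐ≡false A B (body-head d)) (Bot-free-τ B) (perm (⟦⟧-body-∷ Γ Δ B) (ML⇒LJ d))
  ML⇒LJ (⇒ₗ¹ {Γ} {Γ′} {Δ} {Δ′} {B = B} ¬pB d e) rewrite ¬𝒫⇒is-ℐ≡true B ¬pB =
    ⊆-LJ (∷⁺ʳ _ (⟦⟧-++-comm Γ Γ′ Δ Δ′)) (⇒ₗ (ML⇒LJ e) (ML⇒LJ d))
  ML⇒LJ (⇒ₗ² {Γ} {Γ′} {Δ} {Δ′} {B = B} d e) =
    ⊆-LJ (∷⁺ʳ _ (⟦⟧-++-comm Γ Γ′ Δ Δ′)) (impl-left (is-ℐ B) (ML⇒LJ e) (ML⇒LJ d))
  ML⇒LJ (⇒ₗ³ {Γ} {Γ′} {Δ} {Δ′} {A} {B} d e) =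
    ⊆-LJ (∷⁺ʳ _ (⟦⟧-++ Γ Γ′ Δ Δ′))
      (cut (Bot-free-~ (τ A) (Bot-free-τ A))
        (⇒ᵣ (LJ-exchange (impl-left (is-ℐ B) ax (ML⇒LJ d))))
        (perm (⟦⟧-body-∷ Γ′ Δ′ A) (ML⇒LJ e)))
  ML⇒LJ (⇒ᵣ¹ {B = B} d) = impl-right (is-ℐ B) (ML⇒LJ d)
  ML⇒LJ (⇒ᵣ² {Γ} {Δ} {A} {B} d) =
    impl-right-~ (𝒫⇒is-ℐ≡false B (body-head d)) (perm (prep _ (⟦⟧-body-∷ Γ Δ B)) (ML⇒LJ d))

  ⊢⇔⊢LJ : ∀ Γ A → All ℐ Γ → ℐ A → (Γ ⊢ [] ⨾ just A) ⇔ (Γ ⊢LJ A)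
  ⊢⇔⊢LJ Γ A iΓ iA = mk⇔
    (λ d → subst₂ _⊢LJ_ τΓ≡Γ (τ-fixes-ℐ A iA) (ML⇒LJ d))
    (λ d → subst₂ (λ Γ′ A′ → Γ′ ⊢ [] ⨾ just A′)
                  (map-⟨σ⟩-identity σℐ-fixes-IAtom iΓ) (⟨σ⟩-identity σℐ-fixes-IAtom A iA) (LJ⇒ML d))
    where
    τΓ≡Γ : ⟦ Γ ⨾ [] ⟧ ≡ Γ
    τΓ≡Γ = trans (++-identityʳ (map τ Γ)) (map-id-local (All.map (λ {F} → τ-fixes-ℐ F) iΓ))

corollary4p7 : (Vᵢ V꜀ : Set) → let open Setting Vᵢ V꜀ in
    ((Γ Δ : List (Formula 𝓥)) → All 𝒦 Γ → All 𝒦 Δ →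
      ((Γ ⊢ Δ ⨾ nothing) ⇔ (Γ ⊢LK Δ)))
    ×
    ((Γ : List (Formula 𝓥)) (A : Formula 𝓥) → All ℐ Γ → ℐ A →
      ((Γ ⊢ [] ⨾ just A) ⇔ (Γ ⊢LJ A)))
corollary4p7 Vᵢ V꜀ = ⊢⇔⊢LK , ⊢⇔⊢LJ
  where open Fragments Vᵢ V꜀
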